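{- Let $\mathcal{Q}$ be a finite poset. Then the rewrite rule $\to'_\mathcal{Q}$ on binary syntax trees labeled by $\{\star_a:a\in\mathcal{Q}\}$ is terminating.
   Context: For comparable $a,b\in\mathcal{Q}$, $a\uparrow_\mathcal{Q} b:=\min(a,b)$. Syntax trees are planar rooted binary trees whose internal nodes are labeled by symbols $\star_a$, $a\in\mathcal{Q}$; $\star_a\circ_1\star_b$ (resp. $\star_a\circ_2\star_b$) denotes the tree with root $\star_a$ and a node $\star_b$ as left (resp. right) child. The rewrite rule $\to'_\mathcal{Q}$ consists of $\star_a\circ_1\star_b\to'_\mathcal{Q}\star_{a\uparrow b}\circ_2\star_{a\uparrow b}$ for all comparable $a,b$ (including $a=b$), and $\star_a\circ_2\star_b\to'_\mathcal{Q}\star_{a\uparrow b}\circ_2\star_{a\uparrow b}$ for all $a,b$ with $a\prec_\mathcal{Q} b$ or $b\prec_\mathcal{Q} a$. A tree $\mathfrak{t}$ rewrites in one step into $\mathfrak{t}'$ if $\mathfrak{t}'$ is obtained by replacing, at some internal node, a two-internal-node middle subtree equal to a left-hand side by the corresponding right-hand side. The rule is terminating if there is no infinite sequence of one-step rewritings. -}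

module Defs where

open import Level using (Level; _⊔_)
open import Data.Product using (Σ; _×_)
open import Data.List using (List)
open import Data.List.Membership.Propositional using (_∈_)
open import Relation.Nullary using (¬_)
open import Relation.Binary.Core using (Rel)
open import Relation.Binary.Definitions using (Decidable; DecidableEquality)
open import Relation.Binary.Structures using (IsPartialOrder)
open import Relation.Binary.PropositionalEquality using (_≡_)
open import Induction.WellFounded using (WellFounded)
open import Function using (flip)

-- A finite poset: a carrier with a partial order (w.r.t. propositional
-- equality), a finite enumeration of its elements, and (automatic for
-- finite sets classically) decidable equality and decidable order.
record FinitePoset (c ℓ : Level) : Set (Level.suc (c ⊔ ℓ)) where
  field
    Carrier        : Set c
    _≤_            : Rel Carrier ℓ
    isPartialOrder : IsPartialOrder _≡_ _≤_
    elements       : List Carrier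
    complete       : ∀ a → a ∈ elements
    _≟_            : DecidableEquality Carrier
    _≤?_           : Decidable _≤_

data Tree {c} (A : Set c) : Set c where
  leaf : Tree A
  node : A → Tree A → Tree A → Tree A

module Rewrite {c ℓ} (Q : FinitePoset c ℓ) where
  open FinitePoset Q

  _≺_ : Carrier → Carrier → Set (c ⊔ ℓ)
  a ≺ b = (a ≤ b) × ¬ (a ≡ b)

  -- One-step rewriting by →'_Q at some internal node.
  -- (a ↑ b = min(a,b): equal to a when a ≤ b, equal to b when b ≤ a.)
  data _⟶_ : Tree Carrier → Tree Carrier → Set (c ⊔ ℓ) where
    -- ⋆a ∘₁ ⋆b → ⋆(a↑b) ∘₂ ⋆(a↑b), a comparable to b
    left-≤  : ∀ {a b} x y z → a ≤ b →
              node a (node b x y) z ⟶ node a x (node a y z)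
    left-≥  : ∀ {a b} x y z → b ≤ a →
              node a (node b x y) z ⟶ node b x (node b y z)
    -- ⋆a ∘₂ ⋆b → ⋆(a↑b) ∘₂ ⋆(a↑b), a ≺ b or b ≺ a
    right-≺ : ∀ {a b} x y z → a ≺ b →
              node a x (node b y z) ⟶ node a x (node a y z)
    right-≻ : ∀ {a b} x y z → b ≺ a →
              node a x (node b y z) ⟶ node b x (node b y z)
    inside-l : ∀ {a l l' r} → l ⟶ l' → node a l r ⟶ node a l' r
    inside-r : ∀ {a l r r'} → r ⟶ r' → node a l r ⟶ node a l r'

  Terminating : Set (c ⊔ ℓ)
  Terminating = WellFounded (flip _⟶_)

-- Give every label a its rank, the number of elements of Q below it; since Q
-- is finite, ranks are naturals, and they strictly increase along ≺.  A
-- rewrite by ∘₁ is a right rotation, which strictly decreases the sum over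
-- all nodes of the size of the left subtree, while a rewrite by ∘₂ keeps the
-- shape and replaces a label by a strictly smaller one, decreasing the sum of
-- ranks.  Hence every rewrite step decreases the pair (rotation weight, rank
-- sum) lexicographically, a well-founded order on ℕ × ℕ.
module Submission where

open import Defs
open import Data.Nat using (ℕ; suc; _+_; _≤_; _<_; z≤n; s≤s)
open import Data.Nat.Properties using (m≤n⇒m≤1+n; m<m+n; 0<1+n; +-monoˡ-<; +-monoʳ-<; module ≤-Reasoning)
open import Data.Nat.Induction using (<-wellFounded)
open import Data.Nat.Tactic.RingSolver using (solve-∀)
open import Data.Product using (_×_; _,_)
open import Data.Product.Relation.Binary.Lex.Strict using (×-Lex; ×-wellFounded)
open import Data.Sum using (inj₁; inj₂)
open import Data.Empty using (⊥-elim)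
open import Data.List using (List; []; _∷_)
open import Data.List.Membership.Propositional using (_∈_)
open import Data.List.Relation.Unary.Any using (here; there)
open import Relation.Nullary using (¬_; yes; no)
open import Relation.Binary.PropositionalEquality using (_≡_; refl; cong)
open import Relation.Binary.Structures using (IsPartialOrder)
import Relation.Binary.Construct.On as On
open import Induction.WellFounded using (module Subrelation)

size : ∀ {c} {A : Set c} → Tree A → ℕ
size leaf         = 0
size (node _ l r) = suc (size l + size r)

leftWeight : ∀ {c} {A : Set c} → Tree A → ℕ
leftWeight leaf         = 0
leftWeight (node _ l r) = leftWeight l + leftWeight r + size l

labelSum : ∀ {c} {A : Set c} → (A → ℕ) → Tree A → ℕ
labelSum w leaf         = 0
labelSum w (node a l r) = w a + labelSum w l + labelSum w r

module _ {c} {A : Set c} (a b a′ b′ : A) (x y z : Tree A) where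

  rotateʳ-size : size (node a′ x (node b′ y z)) ≡ size (node a (node b x y) z)
  rotateʳ-size = reassociate (size x) (size y) (size z)
    where
    reassociate : ∀ p q r → suc (p + suc (q + r)) ≡ suc (suc (p + q) + r)
    reassociate = solve-∀

  rotateʳ-leftWeight :
    leftWeight (node a′ x (node b′ y z)) < leftWeight (node a (node b x y) z)
  rotateʳ-leftWeight = begin-strict
    leftWeight (node a′ x (node b′ y z))                 <⟨ m<m+n _ 0<1+n ⟩
    leftWeight (node a′ x (node b′ y z)) + suc (size x)
      ≡⟨ rotation (leftWeight x) (leftWeight y) (leftWeight z) (size x) (size y) ⟩
    leftWeight (node a (node b x y) z)                   ∎
    where
    open ≤-Reasoning
    rotation : ∀ wx wy wz sx sy →
      wx + (wy + wz + sy) + sx + suc sx ≡ wx + wy + sx + wz + suc (sx + sy)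
    rotation = solve-∀

module _ {c ℓ} (Q : FinitePoset c ℓ) where
  open FinitePoset Q renaming (_≤_ to _⊑_; _≤?_ to _⊑?_)
  open Rewrite Q
  open IsPartialOrder isPartialOrder using (antisym) renaming (refl to ⊑-refl; trans to ⊑-trans)

  countBelow : Carrier → List Carrier → ℕ
  countBelow a []       = 0
  countBelow a (x ∷ xs) with x ⊑? a
  ... | yes _ = suc (countBelow a xs)
  ... | no  _ = countBelow a xs

  countBelow-mono : ∀ {a b} → a ⊑ b → ∀ xs → countBelow a xs ≤ countBelow b xs
  countBelow-mono a⊑b []       = z≤n
  countBelow-mono {a} {b} a⊑b (x ∷ xs) with x ⊑? a | x ⊑? b
  ... | yes _   | yes _   = s≤s (countBelow-mono a⊑b xs)
  ... | yes x⊑a | no  x⋢b = ⊥-elim (x⋢b (⊑-trans x⊑a a⊑b))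
  ... | no  _   | yes _   = m≤n⇒m≤1+n (countBelow-mono a⊑b xs)
  ... | no  _   | no  _   = countBelow-mono a⊑b xs

  countBelow-strict : ∀ {a b} → a ⊑ b → ¬ b ⊑ a → ∀ {xs} → b ∈ xs →
                      countBelow a xs < countBelow b xs
  countBelow-strict {a} {b} a⊑b b⋢a {x ∷ xs} b∈x∷xs with x ⊑? a | x ⊑? b | b∈x∷xs
  ... | yes x⊑a | no  x⋢b | _         = ⊥-elim (x⋢b (⊑-trans x⊑a a⊑b))
  ... | yes x⊑a | yes _   | here refl = ⊥-elim (b⋢a x⊑a)
  ... | yes _   | yes _   | there b∈xs = s≤s (countBelow-strict a⊑b b⋢a b∈xs)
  ... | no  _   | yes _   | here refl = s≤s (countBelow-mono a⊑b xs)
  ... | no  _   | yes _   | there b∈xs = m≤n⇒m≤1+n (countBelow-strict a⊑b b⋢a b∈xs)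
  ... | no  _   | no  x⋢b | here refl = ⊥-elim (x⋢b ⊑-refl)
  ... | no  _   | no  _   | there b∈xs = countBelow-strict a⊑b b⋢a b∈xs

  rank : Carrier → ℕ
  rank a = countBelow a elements

  rank-strict : ∀ {a b} → a ≺ b → rank a < rank b
  rank-strict (a⊑b , a≢b) =
    countBelow-strict a⊑b (λ b⊑a → a≢b (antisym a⊑b b⊑a)) (complete _)

  ⟶-preserves-size : ∀ {t t′} → t ⟶ t′ → size t′ ≡ size t
  ⟶-preserves-size (left-≤ {a} {b} x y z _) = rotateʳ-size a b a a x y z
  ⟶-preserves-size (left-≥ {a} {b} x y z _) = rotateʳ-size a b b b x y z
  ⟶-preserves-size (right-≺ x y z _) = refl
  ⟶-preserves-size (right-≻ x y z _) = refl
  ⟶-preserves-size (inside-l {r = r} s) = cong (λ n → suc (n + size r)) (⟶-preserves-size s)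
  ⟶-preserves-size (inside-r {l = l} s) = cong (λ n → suc (size l + n)) (⟶-preserves-size s)

  measure : Tree Carrier → ℕ × ℕ
  measure t = leftWeight t , labelSum rank t

  _<ₗₑₓ_ : ℕ × ℕ → ℕ × ℕ → Set
  _<ₗₑₓ_ = ×-Lex _≡_ _<_ _<_

  ⟶-decreases-measure : ∀ {t t′} → t ⟶ t′ → measure t′ <ₗₑₓ measure t
  ⟶-decreases-measure (left-≤ {a} {b} x y z _) = inj₁ (rotateʳ-leftWeight a b a a x y z)
  ⟶-decreases-measure (left-≥ {a} {b} x y z _) = inj₁ (rotateʳ-leftWeight a b b b x y z)
  ⟶-decreases-measure (right-≺ {a} x y z a≺b) =
    inj₂ (refl , +-monoʳ-< (rank a + labelSum rank x)
                   (+-monoˡ-< (labelSum rank z) (+-monoˡ-< (labelSum rank y) (rank-strict a≺b))))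
  ⟶-decreases-measure (right-≻ {b = b} x y z b≺a) =
    inj₂ (refl , +-monoˡ-< (rank b + labelSum rank y + labelSum rank z)
                   (+-monoˡ-< (labelSum rank x) (rank-strict b≺a)))
  ⟶-decreases-measure (inside-l {a} {l} {l′} {r} s)
    with ⟶-decreases-measure s | size l′ | ⟶-preserves-size s
  ... | inj₁ w′<w        | _ | refl = inj₁ (+-monoˡ-< (size l) (+-monoˡ-< (leftWeight r) w′<w))
  ... | inj₂ (w′≡w , σ′<σ) | _ | refl =
    inj₂ ( cong (λ w → w + leftWeight r + size l) w′≡w
         , +-monoˡ-< (labelSum rank r) (+-monoʳ-< (rank a) σ′<σ))
  ⟶-decreases-measure (inside-r {a} {l} s) with ⟶-decreases-measure s
  ... | inj₁ w′<w        = inj₁ (+-monoˡ-< (size l) (+-monoʳ-< (leftWeight l) w′<w))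
  ... | inj₂ (w′≡w , σ′<σ) =
    inj₂ ( cong (λ w → leftWeight l + w + size l) w′≡w
         , +-monoʳ-< (rank a + labelSum rank l) σ′<σ)

lemma3p2 : ∀ {c ℓ} (Q : FinitePoset c ℓ) → Rewrite.Terminating Q
lemma3p2 Q =
  Subrelation.wellFounded (⟶-decreases-measure Q)
    (On.wellFounded (measure Q) (×-wellFounded <-wellFounded <-wellFounded))
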